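{- For $r\geq 1$ and $n\geq 0$, the number of unit interval parking functions of length $n+r$ whose first $r$ entries are distinct equals the $r$-Fubini number $\mathrm{Fub}_n^r=\sum_{k=0}^{n}(k+r)!\left\{\begin{matrix}n+r\\k+r\end{matrix}\right\}_r$.
   Context: Unit interval parking: $N$ cars enter in order $1,\dots,N$ a one-way street with spots $1,\dots,N$; with preference list $\alpha=(a_1,\dots,a_N)\in\{1,\dots,N\}^N$, car $i$ parks in spot $a_i$ if free, otherwise in spot $a_i+1$ if it exists and is free, otherwise it fails; $\alpha$ is a unit interval parking function if all cars park. "First $r$ entries distinct" means $|\{a_1,\dots,a_r\}|=r$. The $r$-Stirling number of the second kind $\left\{\begin{matrix}n+r\\k+r\end{matrix}\right\}_r$ is the number of partitions of the set $\{1,\dots,n+r\}$ into $k+r$ nonempty blocks such that $1,\dots,r$ lie in distinct blocks. -}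

module Defs where

open import Data.Nat using (ℕ; zero; suc; _+_; _*_; _≤_; _⊔_; _!)
open import Data.Nat.Properties using (_≟_; _≤?_)
open import Data.Fin using (Fin; toℕ)
open import Data.Bool using (Bool; true; false; if_then_else_)
open import Data.Maybe using (Maybe; just; nothing; _>>=_; is-just)
open import Data.Nat.ListAction using (sum)
open import Data.List as L using (List; []; _∷_; length; filter; map; upTo; concatMap; take)
open import Data.List.Relation.Unary.Unique.Propositional using (Unique)
open import Data.List.Relation.Unary.Unique.Propositional.Properties using ()
open import Data.Vec as V using (Vec; []; _∷_; toList; lookup; updateAt)
open import Data.Fin.Properties using () renaming (_≟_ to _≟ᶠ_)
open import Data.List.Relation.Unary.Unique.DecPropositional using (unique?)
open import Relation.Binary.PropositionalEquality using (_≡_)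
open import Relation.Nullary using (Dec; yes; no)
open import Relation.Nullary.Decidable using (_×-dec_)
open import Data.Product using (_×_)
open import Data.Fin using (zero; suc)

allVecs : (n k : ℕ) → List (Vec (Fin k) n)
allVecs zero    k = [] ∷ []
allVecs (suc n) k = concatMap (λ v → map (λ a → a ∷ v) (L.allFin k)) (allVecs n k)

-- Unit interval parking.  Spots 1..N are represented by Fin N
-- (spot i+1 ↔ Fin value i).  An occupancy state is a Vec Bool N
-- (true = occupied).

nextSpot : {N : ℕ} → Fin N → Maybe (Fin N)
nextSpot {suc zero}    zero    = nothing
nextSpot {suc (suc N)} zero    = just (suc zero)
nextSpot {suc (suc N)} (suc a) = Data.Maybe.map suc (nextSpot a)
  where import Data.Maybe

occupy : {N : ℕ} → Vec Bool N → Fin N → Vec Bool N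
occupy occ s = updateAt occ s (λ _ → true)

parkOne : {N : ℕ} → Vec Bool N → Fin N → Maybe (Vec Bool N)
parkOne occ a with lookup occ a
... | false = just (occupy occ a)
... | true with nextSpot a
...   | nothing = nothing
...   | just b with lookup occ b
...     | false = just (occupy occ b)
...     | true  = nothing

parkList : {N : ℕ} → Vec Bool N → List (Fin N) → Maybe (Vec Bool N)
parkList occ []       = just occ
parkList occ (a ∷ as) = parkOne occ a >>= λ occ' → parkList occ' as

IsUPF : {N : ℕ} → Vec (Fin N) N → Set
IsUPF {N} α = is-just (parkList (V.replicate N false) (toList α)) ≡ true

FirstDistinct : {N : ℕ} → ℕ → Vec (Fin N) N → Set
FirstDistinct r α = Unique (take r (toList α))

isUPF? : {N : ℕ} (α : Vec (Fin N) N) → Dec (IsUPF α)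
isUPF? {N} α = Data.Bool._≟_ (is-just (parkList (V.replicate N false) (toList α))) true
  where import Data.Bool

firstDistinct? : {N : ℕ} (r : ℕ) (α : Vec (Fin N) N) → Dec (FirstDistinct r α)
firstDistinct? r α = unique? _≟ᶠ_ (take r (toList α))

countUPF : (N r : ℕ) → ℕ
countUPF N r = length (filter (λ α → isUPF? α ×-dec firstDistinct? r α) (allVecs N N))

-- Set partitions of {1..m} into j blocks, encoded canonically as
-- restricted growth strings f : [m] → [j]: blocks are labelled
-- 0,1,2,… in the order of their smallest element, i.e. each f(i) is
-- at most the number of blocks already opened by f(1..i-1), and every
-- label < j is used.

rgsBlocks : {j : ℕ} → ℕ → List (Fin j) → Maybe ℕ
rgsBlocks u []       = just u
rgsBlocks u (v ∷ vs) with toℕ v ≤? u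
... | yes _ = rgsBlocks (u ⊔ suc (toℕ v)) vs
... | no  _ = nothing

IsPartition : {m j : ℕ} → Vec (Fin j) m → Set
IsPartition {m} {j} f = rgsBlocks 0 (toList f) ≡ just j

isPartition? : {m j : ℕ} (f : Vec (Fin j) m) → Dec (IsPartition f)
isPartition? {m} {j} f = Data.Maybe.Properties.≡-dec _≟_ (rgsBlocks 0 (toList f)) (just j)
  where import Data.Maybe.Properties

FirstSeparated : {m j : ℕ} → ℕ → Vec (Fin j) m → Set
FirstSeparated r f = Unique (take r (toList f))

firstSeparated? : {m j : ℕ} (r : ℕ) (f : Vec (Fin j) m) → Dec (FirstSeparated r f)
firstSeparated? r f = unique? _≟ᶠ_ (take r (toList f))

rStirling2 : (r m j : ℕ) → ℕ
rStirling2 r m j =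
  length (filter (λ f → isPartition? f ×-dec firstSeparated? r f) (allVecs m j))

rFubini : (n r : ℕ) → ℕ
rFubini n r = sum (map (λ k → (k + r) ! * rStirling2 r (n + r) (k + r)) (upTo (suc n)))

-- Both sides satisfy F 0 r = r! and F (n + 1) r = r · F n r + F n (r + 1).
--
-- Fubini side: a restricted growth string whose first r letters are distinct starts with 0, …, r − 1,
-- so {n + r, k + r}_r counts words of length n continuing a string with r open blocks to exactly k + r
-- blocks.  The next letter either reuses one of the u open blocks or opens block u, which gives the
-- recurrence after summing (k + u)! times these counts over k.
--
-- Parking side: the first r cars park at their distinct preferred spots, so the count is r! times
-- P(N, r, m), the number of ways m further cars park, summed over the r-sets of occupied spots of a
-- street of length N = m + r.  The next car either parks at its free preferred spot, turning r-sets
-- into (r + 1)-sets in r + 1 ways, or is bumped from an occupied spot to the free spot behind it.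
-- Deleting that spot gives a street of length N − 1 in which one of the r occupied spots counts
-- double; since a run of occupied spots behaves like a single one, the doubling is invisible and
-- P(N + 1, r, m + 1) = (r + 1) P(N + 1, r + 1, m) + r P(N, r, m).

module Submission where

open import Defs
open import Data.Nat using (ℕ; _+_; _≥_)
open import Relation.Binary.PropositionalEquality using (_≡_)

open import Algebra.Bundles using (CommutativeMonoid)
import Algebra.Properties.CommutativeSemigroup as CommSemigroupProperties
open import Data.Bool as B using (Bool; true; false; not; _∧_)
open import Data.Bool.ListAction using (all; and)
open import Data.Bool.Properties using (∧-identityʳ; ∧-zeroʳ; ∧-commutativeMonoid)
open import Data.Fin using (Fin; zero; suc; toℕ; inject₁; fromℕ)
open import Data.Fin.Properties using (toℕ-inject₁; toℕ-fromℕ; toℕ<n; toℕ-injective)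
  renaming (_≟_ to _≟ᶠ_)
open import Data.List as L using (List; []; _∷_; length; filter; map; tabulate; concatMap; _++_)
open import Data.List.Properties using (length-++; map-tabulate; filter-++; map-cong)
import Data.List.Relation.Unary.All as All
open import Data.List.Relation.Unary.Unique.DecPropositional using (unique?)
open import Data.Maybe as M using (just; nothing; is-just; maybe′)
open import Data.Maybe.Properties using (maybe′-map; ≡-dec)
open import Data.Nat
  using (zero; suc; _*_; _∸_; _≤_; _<_; _⊔_; _⊓_; _!; _≤ᵇ_; _≡ᵇ_; s≤s; z≤n; z<s)
open import Data.Nat.Combinatorics using (_C_; nCn≡1; nC1≡n; nCk≡nC[n∸k]; nCk+nC[k+1]≡[n+1]C[k+1])
open import Data.Nat.ListAction using (sum)
open import Data.Nat.Properties
open import Data.Product using (_×_; _,_)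
open import Data.Sum using (_⊎_; inj₁; inj₂; [_,_]′)
open import Data.Vec as V using (Vec; []; _∷_; toList; lookup)
open import Data.Vec.Properties using (lookup∘updateAt; lookup∘updateAt′; lookup-replicate; length-toList)
open import Function using (id; _∘_)
open import Level using (Level)
open import Relation.Binary.Definitions using (DecidableEquality; Tri; tri<; tri≈; tri>)
open import Relation.Binary.PropositionalEquality using (refl; sym; trans; cong; cong₂; subst; module ≡-Reasoning)
open import Relation.Nullary using (does; ¬?; yes; no; _×-dec_)
open import Relation.Nullary.Decidable using (dec-true; dec-false)
open import Relation.Unary using (Pred; Decidable)

open import Algebra.Properties.Semiring.Sum +-*-semiring
  using (sum-syntax; ∑-distrib-+; *-distribˡ-sum; sum-cong-≗; sum-replicate-zero; sum-init-last)
open CommSemigroupProperties +-commutativeSemigroup using (interchange; x∙yz≈y∙xz; x∙yz≈xz∙y)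
module *-Props = CommSemigroupProperties *-commutativeSemigroup
module ∧-Props = CommSemigroupProperties (CommutativeMonoid.commutativeSemigroup ∧-commutativeMonoid)

private variable
  ℓ : Level
  A : Set
  m k : ℕ

𝟙 : Bool → ℕ
𝟙 true  = 1
𝟙 false = 0

∑-const : (n c : ℕ) → ∑[ i < n ] c ≡ n * c
∑-const zero    c = refl
∑-const (suc n) c = cong (c +_) (∑-const n c)

≤ᵇ-suc : (m n : ℕ) → (suc m ≤ᵇ suc n) ≡ (m ≤ᵇ n)
≤ᵇ-suc zero    n = refl
≤ᵇ-suc (suc m) n = refl

∑-≤ᵇ : (f : ℕ → ℕ) (u j : ℕ) →
  ∑[ a < j ] (𝟙 (toℕ a ≤ᵇ u) * f (toℕ a)) ≡ ∑[ i < j ⊓ suc u ] f (toℕ i)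
∑-≤ᵇ f u       zero    = refl
∑-≤ᵇ f zero    (suc j) = cong₂ _+_ (*-identityˡ (f 0))
  (trans (sum-replicate-zero j) (cong (λ n → ∑[ i < n ] f (suc (toℕ i))) (sym (⊓-zeroʳ j))))
∑-≤ᵇ f (suc u) (suc j) = cong₂ _+_ (*-identityˡ (f 0))
  (trans (sum-cong-≗ {j} (λ a → cong (λ b → 𝟙 b * f (suc (toℕ a))) (≤ᵇ-suc (toℕ a) u)))
         (∑-≤ᵇ (f ∘ suc) u j))

∑-≡ᵇ : (f : ℕ → ℕ) {u j : ℕ} → u < j → ∑[ a < j ] (𝟙 (toℕ a ≡ᵇ u) * f (toℕ a)) ≡ f u
∑-≡ᵇ f {zero}  {suc j} _         =
  trans (cong₂ _+_ (*-identityˡ (f 0)) (sum-replicate-zero j)) (+-identityʳ (f 0))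
∑-≡ᵇ f {suc u} {suc j} (s≤s u<j) = ∑-≡ᵇ (f ∘ suc) u<j

sum-map-applyUpTo : (f g : ℕ → ℕ) (m : ℕ) → sum (map f (L.applyUpTo g m)) ≡ ∑[ k < m ] f (g (toℕ k))
sum-map-applyUpTo f g zero    = refl
sum-map-applyUpTo f g (suc m) = cong (f (g 0) +_) (sum-map-applyUpTo f (g ∘ suc) m)

nC0≡1 : (n : ℕ) → n C 0 ≡ 1
nC0≡1 n = trans (nCk≡nC[n∸k] {0} {n} z≤n) (nCn≡1 n)

[r+1]Cr≡1+r : (r : ℕ) → (r + 1) C r ≡ suc r
[r+1]Cr≡1+r r = begin
  (r + 1) C r             ≡⟨ nCk≡nC[n∸k] (m≤m+n r 1) ⟩
  (r + 1) C (r + 1 ∸ r)   ≡⟨ cong ((r + 1) C_) (m+n∸m≡n r 1) ⟩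
  (r + 1) C 1             ≡⟨ nC1≡n (r + 1) ⟩
  r + 1                   ≡⟨ +-comm r 1 ⟩
  suc r                   ∎
  where open ≡-Reasoning

r!*[1+r]*x≡[1+r]!*x : (r x : ℕ) → r ! * (suc r * x) ≡ suc r ! * x
r!*[1+r]*x≡[1+r]!*x r x = trans (*-Props.x∙yz≈y∙xz (r !) (suc r) x) (sym (*-assoc (suc r) (r !) x))

does-≟-true : (b : Bool) → does (b B.≟ true) ≡ b
does-≟-true true  = refl
does-≟-true false = refl

all-true : (xs : List A) → all (λ _ → true) xs ≡ true
all-true []       = refl
all-true (x ∷ xs) = all-true xs

module _ {A : Set} (_≟_ : DecidableEquality A) where

  distinctWithin : (A → Bool) → List A → Bool
  distinctWithin q xs = does (unique? _≟_ xs) ∧ all q xs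

  distinctWithin-cong : {q q′ : A → Bool} → (∀ y → q y ≡ q′ y) → (xs : List A) →
    distinctWithin q xs ≡ distinctWithin q′ xs
  distinctWithin-cong q≗q′ xs = cong (λ ys → does (unique? _≟_ xs) ∧ and ys) (map-cong q≗q′ xs)

  private
    all-avoiding : (a : A) (q : A → Bool) (xs : List A) →
      all (λ y → not (does (a ≟ y)) ∧ q y) xs ≡ does (All.all? (λ y → ¬? (a ≟ y)) xs) ∧ all q xs
    all-avoiding a q []       = refl
    all-avoiding a q (y ∷ xs) = trans (cong ((not (does (a ≟ y)) ∧ q y) ∧_) (all-avoiding a q xs))
                                      (∧-Props.interchange (not (does (a ≟ y))) (q y) _ _)

  distinctWithin-∷ : (q : A → Bool) (a : A) (xs : List A) →
    distinctWithin q (a ∷ xs) ≡ q a ∧ distinctWithin (λ y → not (does (a ≟ y)) ∧ q y) xs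
  distinctWithin-∷ q a xs = trans (rearrange (does (All.all? (λ y → ¬? (a ≟ y)) xs)) (q a))
    (cong (λ b → q a ∧ (does (unique? _≟_ xs) ∧ b)) (sym (all-avoiding a q xs)))
    where
    rearrange : (avoids qa : Bool) → (avoids ∧ does (unique? _≟_ xs)) ∧ (qa ∧ all q xs)
                                     ≡ qa ∧ (does (unique? _≟_ xs) ∧ (avoids ∧ all q xs))
    rearrange avoids true  = ∧-Props.xy∙z≈y∙xz avoids _ _
    rearrange avoids false = ∧-zeroʳ _

-- Counting vectors

#vecs : (m k : ℕ) → (Vec (Fin k) m → Bool) → ℕ
#vecs zero    k p = 𝟙 (p [])
#vecs (suc m) k p = ∑[ a < k ] #vecs m k (λ v → p (a ∷ v))

#vecs-cong : {p q : Vec (Fin k) m → Bool} → (∀ v → p v ≡ q v) → #vecs m k p ≡ #vecs m k q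
#vecs-cong {m = zero}  p≗q = cong 𝟙 (p≗q [])
#vecs-cong {m = suc m} p≗q = sum-cong-≗ (λ a → #vecs-cong (λ v → p≗q (a ∷ v)))

#vecs-false : #vecs m k (λ _ → false) ≡ 0
#vecs-false {m = zero}      = refl
#vecs-false {m = suc m} {k} = trans (sum-cong-≗ {k} (λ _ → #vecs-false {m} {k})) (sum-replicate-zero k)

#vecs-∧ : (b : Bool) (p : Vec (Fin k) m → Bool) → #vecs m k (λ v → b ∧ p v) ≡ 𝟙 b * #vecs m k p
#vecs-∧ true  p = sym (+-identityʳ _)
#vecs-∧ {k = k} {m = m} false p = #vecs-false {m} {k}

length-filter-∷ : {P : Pred A ℓ} (P? : Decidable P) (x : A) (xs : List A) →
  length (filter P? (x ∷ xs)) ≡ 𝟙 (does (P? x)) + length (filter P? xs)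
length-filter-∷ P? x xs with does (P? x)
... | true  = refl
... | false = refl

length-filter-tabulate : {P : Pred A ℓ} (P? : Decidable P) (g : Fin k → A) →
  length (filter P? (tabulate g)) ≡ ∑[ a < k ] 𝟙 (does (P? (g a)))
length-filter-tabulate {k = zero}  P? g = refl
length-filter-tabulate {k = suc k} P? g = trans (length-filter-∷ P? (g zero) (tabulate (g ∘ suc)))
  (cong (𝟙 (does (P? (g zero))) +_) (length-filter-tabulate P? (g ∘ suc)))

length-filter-extend : {P : Pred (Vec (Fin k) (suc m)) ℓ} (P? : Decidable P) (vs : List (Vec (Fin k) m)) →
  length (filter P? (concatMap (λ v → map (λ a → a ∷ v) (L.allFin k)) vs))
    ≡ ∑[ a < k ] length (filter (λ v → P? (a ∷ v)) vs)
length-filter-extend {k = k} P? [] = sym (sum-replicate-zero k)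
length-filter-extend {k = k} P? (v ∷ vs) = begin
    length (filter P? (extensions v ++ concatMap extensions vs))
  ≡⟨ cong length (filter-++ P? (extensions v) _) ⟩
    length (filter P? (extensions v) ++ filter P? (concatMap extensions vs))
  ≡⟨ length-++ (filter P? (extensions v)) ⟩
    length (filter P? (extensions v)) + length (filter P? (concatMap extensions vs))
  ≡⟨ cong₂ _+_ (trans (cong (λ xs → length (filter P? xs)) (map-tabulate id (_∷ v)))
                      (length-filter-tabulate P? (_∷ v)))
               (length-filter-extend P? vs) ⟩
    ∑[ a < k ] 𝟙 (does (P? (a ∷ v))) + ∑[ a < k ] length (filter (λ w → P? (a ∷ w)) vs)
  ≡⟨ sym (∑-distrib-+ {k} _ _) ⟩
    ∑[ a < k ] (𝟙 (does (P? (a ∷ v))) + length (filter (λ w → P? (a ∷ w)) vs))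
  ≡⟨ sum-cong-≗ (λ a → sym (length-filter-∷ (λ w → P? (a ∷ w)) v vs)) ⟩
    ∑[ a < k ] length (filter (λ w → P? (a ∷ w)) (v ∷ vs)) ∎
  where
  open ≡-Reasoning
  extensions : Vec (Fin k) m → List (Vec (Fin k) (suc m))
  extensions w = map (λ a → a ∷ w) (L.allFin k)

length-filter-allVecs : {P : Pred (Vec (Fin k) m) ℓ} (P? : Decidable P) →
  length (filter P? (allVecs m k)) ≡ #vecs m k (λ v → does (P? v))
length-filter-allVecs {m = zero}  P? = trans (length-filter-∷ P? [] []) (+-identityʳ _)
length-filter-allVecs {m = suc m} P? = trans (length-filter-extend P? (allVecs m _))
  (sum-cong-≗ (λ a → length-filter-allVecs (λ v → P? (a ∷ v))))

rFub : ℕ → ℕ → ℕ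
rFub zero    r = r !
rFub (suc n) r = r * rFub n r + rFub n (suc r)

-- Unit interval parking

Street : ℕ → Set
Street = Vec Bool

emptyStreet : (N : ℕ) → Street N
emptyStreet N = V.replicate N false

free : {N : ℕ} → Street N → Fin N → Bool
free o i = not (lookup o i)

parks : {N : ℕ} → Street N → List (Fin N) → Bool
parks o xs = is-just (parkList o xs)

#parking : {N : ℕ} → Street N → ℕ → ℕ
#parking {N} o m = #vecs m N (λ v → parks o (toList v))

sumOccupying : {N : ℕ} → ℕ → Street N → (Street N → ℕ) → ℕ
sumOccupying zero    o           f = f o
sumOccupying (suc r) []          f = 0
sumOccupying (suc r) (true ∷ o)  f = sumOccupying (suc r) o (f ∘ (true ∷_))
sumOccupying (suc r) (false ∷ o) f =
  sumOccupying r o (f ∘ (true ∷_)) + sumOccupying (suc r) o (f ∘ (false ∷_))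

-- Sums over the free spots whose left neighbour is occupied, where a bumped car ends up; the flag
-- records whether the spot just left of the street is occupied.
sumBumped : {N : ℕ} → Bool → Street N → (Street N → ℕ) → ℕ
sumBumped _     []          f = 0
sumBumped _     (true ∷ o)  f = sumBumped true o (f ∘ (true ∷_))
sumBumped false (false ∷ o) f = sumBumped false o (f ∘ (false ∷_))
sumBumped true  (false ∷ o) f = f (true ∷ o) + sumBumped false o (f ∘ (false ∷_))

parkOne-suc : {N : ℕ} (x : Bool) (o : Street N) (a : Fin N) →
  parkOne (x ∷ o) (suc a) ≡ M.map (x ∷_) (parkOne o a)
parkOne-suc {suc N} x o a with lookup o a
... | false = refl
... | true with nextSpot a
...   | nothing = refl
...   | just b with lookup o b
...     | false = refl
...     | true  = refl

parkOne-free : {N : ℕ} (o : Street N) (a : Fin N) → lookup o a ≡ false → parkOne o a ≡ just (occupy o a)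
parkOne-free o a eq with lookup o a
parkOne-free o a refl | false = refl

∑-parkOne : {N : ℕ} (o : Street N) (f : Street N → ℕ) →
  ∑[ a < N ] maybe′ f 0 (parkOne o a) ≡ sumOccupying 1 o f + sumBumped false o f
∑-parkOne []      f = refl
∑-parkOne {suc N} (x ∷ o) f = begin
    maybe′ f 0 (parkOne (x ∷ o) zero) + ∑[ a < N ] maybe′ f 0 (parkOne (x ∷ o) (suc a))
  ≡⟨ cong (maybe′ f 0 (parkOne (x ∷ o) zero) +_) (sum-cong-≗ {N} λ a →
       trans (cong (maybe′ f 0) (parkOne-suc x o a)) (maybe′-map f 0 (x ∷_) (parkOne o a))) ⟩
    maybe′ f 0 (parkOne (x ∷ o) zero) + ∑[ a < N ] maybe′ (f ∘ (x ∷_)) 0 (parkOne o a)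
  ≡⟨ cong (maybe′ f 0 (parkOne (x ∷ o) zero) +_) (∑-parkOne o (f ∘ (x ∷_))) ⟩
    maybe′ f 0 (parkOne (x ∷ o) zero) + (sumOccupying 1 o (f ∘ (x ∷_)) + sumBumped false o (f ∘ (x ∷_)))
  ≡⟨ first-spot x ⟩
    sumOccupying 1 (x ∷ o) f + sumBumped false (x ∷ o) f ∎
  where
  open ≡-Reasoning
  g₁ : Street N → ℕ
  g₁ = f ∘ (true ∷_)
  bumped-from-first : (o′ : Street N) →
    maybe′ f 0 (parkOne (true ∷ o′) zero) + sumBumped false o′ g₁ ≡ sumBumped true o′ g₁
  bumped-from-first []          = refl
  bumped-from-first (false ∷ _) = refl
  bumped-from-first (true  ∷ _) = refl
  first-spot : (x : Bool) →
    maybe′ f 0 (parkOne (x ∷ o) zero) + (sumOccupying 1 o (f ∘ (x ∷_)) + sumBumped false o (f ∘ (x ∷_)))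
      ≡ sumOccupying 1 (x ∷ o) f + sumBumped false (x ∷ o) f
  first-spot false = sym (+-assoc (f (true ∷ o)) _ _)
  first-spot true  = trans (x∙yz≈y∙xz (maybe′ f 0 (parkOne (true ∷ o) zero)) (sumOccupying 1 o g₁) _)
    (cong (sumOccupying 1 o g₁ +_) (bumped-from-first o))

#parking-suc : {N : ℕ} (o : Street N) (m : ℕ) →
  #parking o (suc m)
    ≡ sumOccupying 1 o (λ o′ → #parking o′ m) + sumBumped false o (λ o′ → #parking o′ m)
#parking-suc {N} o m = trans (sum-cong-≗ {N} first-car) (∑-parkOne o (λ o′ → #parking o′ m))
  where
  first-car : (a : Fin N) →
    #vecs m N (λ v → parks o (a ∷ toList v)) ≡ maybe′ (λ o′ → #parking o′ m) 0 (parkOne o a)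
  first-car a with parkOne o a
  ... | nothing = #vecs-false {m} {N}
  ... | just o′ = refl

data Contraction : {n : ℕ} → Street (suc n) → Street n → Set where
  here  : {n : ℕ} {o : Street n} → Contraction (true ∷ true ∷ o) (true ∷ o)
  there : {n : ℕ} {b : Bool} {o : Street (suc n)} {o′ : Street n} →
          Contraction o o′ → Contraction (b ∷ o) (b ∷ o′)

AgreeAlongContractions : {n : ℕ} → (Street (suc n) → ℕ) → (Street n → ℕ) → Set
AgreeAlongContractions f g = ∀ {o o′} → Contraction o o′ → f o ≡ g o′

sumOccupying-cong : {N : ℕ} (r : ℕ) (o : Street N) {f g : Street N → ℕ} → (∀ x → f x ≡ g x) →
  sumOccupying r o f ≡ sumOccupying r o g
sumOccupying-cong zero    o           f≗g = f≗g o
sumOccupying-cong (suc r) []          f≗g = refl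
sumOccupying-cong (suc r) (true ∷ o)  f≗g = sumOccupying-cong (suc r) o (f≗g ∘ (true ∷_))
sumOccupying-cong (suc r) (false ∷ o) f≗g =
  cong₂ _+_ (sumOccupying-cong r o (f≗g ∘ (true ∷_))) (sumOccupying-cong (suc r) o (f≗g ∘ (false ∷_)))

sumBumped-cong : {N : ℕ} (b : Bool) (o : Street N) {f g : Street N → ℕ} → (∀ x → f x ≡ g x) →
  sumBumped b o f ≡ sumBumped b o g
sumBumped-cong _     []          f≗g = refl
sumBumped-cong _     (true ∷ o)  f≗g = sumBumped-cong true o (f≗g ∘ (true ∷_))
sumBumped-cong false (false ∷ o) f≗g = sumBumped-cong false o (f≗g ∘ (false ∷_))
sumBumped-cong true  (false ∷ o) f≗g = cong₂ _+_ (f≗g _) (sumBumped-cong false o (f≗g ∘ (false ∷_)))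

sumOccupying-contraction : {n : ℕ} (r : ℕ) {o : Street (suc n)} {o′ : Street n}
  {f : Street (suc n) → ℕ} {g : Street n → ℕ} →
  AgreeAlongContractions f g → Contraction o o′ → sumOccupying r o f ≡ sumOccupying r o′ g
sumOccupying-contraction zero    f≈g c                     = f≈g c
sumOccupying-contraction (suc r) f≈g (here {o = o})        = sumOccupying-cong (suc r) o (λ _ → f≈g here)
sumOccupying-contraction (suc r) f≈g (there {b = true}  c) = sumOccupying-contraction (suc r) (f≈g ∘ there) c
sumOccupying-contraction (suc r) f≈g (there {b = false} c) =
  cong₂ _+_ (sumOccupying-contraction r (f≈g ∘ there) c) (sumOccupying-contraction (suc r) (f≈g ∘ there) c)

sumBumped-contraction : {n : ℕ} (b : Bool) {o : Street (suc n)} {o′ : Street n}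
  {f : Street (suc n) → ℕ} {g : Street n → ℕ} →
  AgreeAlongContractions f g → Contraction o o′ → sumBumped b o f ≡ sumBumped b o′ g
sumBumped-contraction _     f≈g (here {o = o}) = sumBumped-cong true o (λ _ → f≈g here)
sumBumped-contraction false f≈g (there {b = false} c) = sumBumped-contraction false (f≈g ∘ there) c
sumBumped-contraction true  f≈g (there {b = false} c) =
  cong₂ _+_ (f≈g (there c)) (sumBumped-contraction false (f≈g ∘ there) c)
sumBumped-contraction _     f≈g (there {b = true}  c) = sumBumped-contraction true (f≈g ∘ there) c

-- A car arriving at an occupied spot can only use the spot right after it, so the length of a run of
-- occupied spots is invisible to the cars that follow.
#parking-contraction : {n : ℕ} (m : ℕ) →
  AgreeAlongContractions {n} (λ o → #parking o m) (λ o′ → #parking o′ m)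
#parking-contraction zero    c = refl
#parking-contraction (suc m) {o} {o′} c = begin
    #parking o (suc m)
  ≡⟨ #parking-suc o m ⟩
    sumOccupying 1 o (λ x → #parking x m) + sumBumped false o (λ x → #parking x m)
  ≡⟨ cong₂ _+_ (sumOccupying-contraction 1 (#parking-contraction m) c)
               (sumBumped-contraction false (#parking-contraction m) c) ⟩
    sumOccupying 1 o′ (λ x → #parking x m) + sumBumped false o′ (λ x → #parking x m)
  ≡⟨ sym (#parking-suc o′ m) ⟩
    #parking o′ (suc m) ∎
  where open ≡-Reasoning

sumOccupying-+ : {N : ℕ} (r : ℕ) (o : Street N) (f g : Street N → ℕ) →
  sumOccupying r o (λ x → f x + g x) ≡ sumOccupying r o f + sumOccupying r o g
sumOccupying-+ zero    o           f g = refl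
sumOccupying-+ (suc r) []          f g = refl
sumOccupying-+ (suc r) (true ∷ o)  f g = sumOccupying-+ (suc r) o (f ∘ (true ∷_)) (g ∘ (true ∷_))
sumOccupying-+ (suc r) (false ∷ o) f g = trans
  (cong₂ _+_ (sumOccupying-+ r o (f ∘ (true ∷_)) (g ∘ (true ∷_)))
             (sumOccupying-+ (suc r) o (f ∘ (false ∷_)) (g ∘ (false ∷_))))
  (interchange (sumOccupying r o (f ∘ (true ∷_))) _ _ _)

sumOccupying-* : {N : ℕ} (r c : ℕ) (o : Street N) (f : Street N → ℕ) →
  sumOccupying r o (λ x → c * f x) ≡ c * sumOccupying r o f
sumOccupying-* zero    c o           f = refl
sumOccupying-* (suc r) c []          f = sym (*-zeroʳ c)
sumOccupying-* (suc r) c (true ∷ o)  f = sumOccupying-* (suc r) c o (f ∘ (true ∷_))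
sumOccupying-* (suc r) c (false ∷ o) f = trans
  (cong₂ _+_ (sumOccupying-* r c o (f ∘ (true ∷_))) (sumOccupying-* (suc r) c o (f ∘ (false ∷_))))
  (sym (*-distribˡ-+ c _ _))

sumOccupying-sumOccupying : {N : ℕ} (r s : ℕ) (o : Street N) (f : Street N → ℕ) →
  sumOccupying r o (λ x → sumOccupying s x f) ≡ ((r + s) C r) * sumOccupying (r + s) o f
sumOccupying-sumOccupying zero          s       o           f =
  sym (begin
    (s C 0) * sumOccupying s o f ≡⟨ cong (λ c → c * sumOccupying s o f) (nC0≡1 s) ⟩
    1 * sumOccupying s o f     ≡⟨ *-identityˡ _ ⟩
    sumOccupying s o f         ∎)
  where open ≡-Reasoning
sumOccupying-sumOccupying r@(suc _)     zero    o           f = sym (begin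
    ((r + 0) C r) * sumOccupying (r + 0) o f ≡⟨ cong (λ n → (n C r) * sumOccupying n o f) (+-identityʳ r) ⟩
    (r C r) * sumOccupying r o f            ≡⟨ cong (_* sumOccupying r o f) (nCn≡1 r) ⟩
    1 * sumOccupying r o f                 ≡⟨ *-identityˡ _ ⟩
    sumOccupying r o f                     ∎)
  where open ≡-Reasoning
sumOccupying-sumOccupying (suc r)       (suc s) []          f = sym (*-zeroʳ ((suc r + suc s) C suc r))
sumOccupying-sumOccupying (suc r)       (suc s) (true ∷ o)  f =
  sumOccupying-sumOccupying (suc r) (suc s) o (f ∘ (true ∷_))
sumOccupying-sumOccupying (suc r)       (suc s) (false ∷ o) f = begin
    sumOccupying r o (λ x → sumOccupying (suc s) x taken)
      + sumOccupying (suc r) o (λ x → sumOccupying s x taken + sumOccupying (suc s) x left)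
  ≡⟨ cong (sumOccupying r o (λ x → sumOccupying (suc s) x taken) +_) (sumOccupying-+ (suc r) o _ _) ⟩
    sumOccupying r o (λ x → sumOccupying (suc s) x taken)
      + (sumOccupying (suc r) o (λ x → sumOccupying s x taken)
         + sumOccupying (suc r) o (λ x → sumOccupying (suc s) x left))
  ≡⟨ cong₂ _+_ (sumOccupying-sumOccupying r (suc s) o taken)
               (cong₂ _+_ (trans (sumOccupying-sumOccupying (suc r) s o taken)
                                 (cong (λ n → (n C suc r) * sumOccupying n o taken) (sym (+-suc r s))))
                          (sumOccupying-sumOccupying (suc r) (suc s) o left)) ⟩
    (M C r) * first-taken + ((M C suc r) * first-taken + (suc M C suc r) * first-left)
  ≡⟨ sym (+-assoc ((M C r) * first-taken) _ _) ⟩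
    (M C r) * first-taken + (M C suc r) * first-taken + (suc M C suc r) * first-left
  ≡⟨ cong (_+ (suc M C suc r) * first-left) (sym (*-distribʳ-+ first-taken (M C r) (M C suc r))) ⟩
    (M C r + M C suc r) * first-taken + (suc M C suc r) * first-left
  ≡⟨ cong (λ c → c * first-taken + (suc M C suc r) * first-left) (nCk+nC[k+1]≡[n+1]C[k+1] M r) ⟩
    (suc M C suc r) * first-taken + (suc M C suc r) * first-left
  ≡⟨ sym (*-distribˡ-+ (suc M C suc r) first-taken first-left) ⟩
    (suc M C suc r) * (first-taken + first-left) ∎
  where
  open ≡-Reasoning
  taken left : Street _ → ℕ
  taken = f ∘ (true ∷_)
  left  = f ∘ (false ∷_)
  M = r + suc s
  first-taken = sumOccupying M o taken
  first-left  = sumOccupying (suc M) o left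

#occupied : {n : ℕ} → Street n → ℕ
#occupied []          = 0
#occupied (true ∷ o)  = suc (#occupied o)
#occupied (false ∷ o) = #occupied o

#occupied-emptyStreet : (N : ℕ) → #occupied (emptyStreet N) ≡ 0
#occupied-emptyStreet zero    = refl
#occupied-emptyStreet (suc N) = #occupied-emptyStreet N

sumOccupying-#occupied : {N : ℕ} (r : ℕ) (o : Street N) (h : Street N → ℕ) →
  sumOccupying r o (λ x → #occupied x * h x) ≡ (#occupied o + r) * sumOccupying r o h
sumOccupying-#occupied zero    o           h = cong (_* h o) (sym (+-identityʳ (#occupied o)))
sumOccupying-#occupied (suc r) []          h = sym (*-zeroʳ (suc r))
sumOccupying-#occupied (suc r) (true ∷ o)  h = trans
  (sumOccupying-+ (suc r) o (h ∘ (true ∷_)) (λ x → #occupied x * h (true ∷ x)))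
  (cong (sumOccupying (suc r) o (h ∘ (true ∷_)) +_) (sumOccupying-#occupied (suc r) o (h ∘ (true ∷_))))
sumOccupying-#occupied (suc r) (false ∷ o) h = begin
    sumOccupying r o (λ x → h (true ∷ x) + #occupied x * h (true ∷ x))
      + sumOccupying (suc r) o (λ x → #occupied x * h (false ∷ x))
  ≡⟨ cong₂ _+_ (trans (sumOccupying-+ r o h₁ (λ x → #occupied x * h₁ x))
                      (cong (sumOccupying r o h₁ +_) (sumOccupying-#occupied r o h₁)))
               (sumOccupying-#occupied (suc r) o h₀) ⟩
    suc (#occupied o + r) * sumOccupying r o h₁ + (#occupied o + suc r) * sumOccupying (suc r) o h₀
  ≡⟨ cong (λ c → c * sumOccupying r o h₁ + (#occupied o + suc r) * sumOccupying (suc r) o h₀)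
          (sym (+-suc (#occupied o) r)) ⟩
    (#occupied o + suc r) * sumOccupying r o h₁ + (#occupied o + suc r) * sumOccupying (suc r) o h₀
  ≡⟨ sym (*-distribˡ-+ (#occupied o + suc r) (sumOccupying r o h₁) (sumOccupying (suc r) o h₀)) ⟩
    (#occupied o + suc r) * sumOccupying (suc r) (false ∷ o) h ∎
  where
  open ≡-Reasoning
  h₁ h₀ : Street _ → ℕ
  h₁ = h ∘ (true ∷_)
  h₀ = h ∘ (false ∷_)

sumOccupying-overfull : {N r : ℕ} (f : Street N → ℕ) → N < r → sumOccupying r (emptyStreet N) f ≡ 0
sumOccupying-overfull {zero}  {suc r} f N<r           = refl
sumOccupying-overfull {suc N} {suc r} f (s≤s N<r) =
  cong₂ _+_ (sumOccupying-overfull (f ∘ (true ∷_)) N<r)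
            (sumOccupying-overfull (f ∘ (false ∷_)) (m<n⇒m<1+n N<r))

sumOccupying-all : (N : ℕ) (f : Street N → ℕ) → sumOccupying N (emptyStreet N) f ≡ f (V.replicate N true)
sumOccupying-all zero    f = refl
sumOccupying-all (suc N) f = trans
  (cong₂ _+_ (sumOccupying-all N (f ∘ (true ∷_))) (sumOccupying-overfull (f ∘ (false ∷_)) (n<1+n N)))
  (+-identityʳ _)

sumDoubling : {n : ℕ} → Street n → (Street (suc n) → ℕ) → ℕ
sumDoubling []          f = 0
sumDoubling (true ∷ o)  f = f (true ∷ true ∷ o) + sumDoubling o (f ∘ (true ∷_))
sumDoubling (false ∷ o) f = sumDoubling o (f ∘ (false ∷_))

sumDoubling-contraction : {n : ℕ} (o : Street n) {f : Street (suc n) → ℕ} {g : Street n → ℕ} →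
  AgreeAlongContractions f g → sumDoubling o f ≡ #occupied o * g o
sumDoubling-contraction []          f≈g = refl
sumDoubling-contraction (true ∷ o)  f≈g = cong₂ _+_ (f≈g here) (sumDoubling-contraction o (f≈g ∘ there))
sumDoubling-contraction (false ∷ o) f≈g = sumDoubling-contraction o (f≈g ∘ there)

sumOccupying-sumBumped-true : {N : ℕ} (r : ℕ) (o : Street N) (f : Street (suc N) → ℕ) →
  sumOccupying r (false ∷ o) (λ x → sumBumped true x f)
    ≡ sumOccupying r (false ∷ o) (λ x → sumBumped false x f) + sumOccupying r o (f ∘ (true ∷_))
sumOccupying-sumBumped-true zero    o f = +-comm (f (true ∷ o)) _
sumOccupying-sumBumped-true (suc r) o f = trans
  (cong (sumOccupying r o (λ x → sumBumped true x (f ∘ (true ∷_))) +_)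
        (sumOccupying-+ (suc r) o (f ∘ (true ∷_)) (λ x → sumBumped false x (f ∘ (false ∷_)))))
  (x∙yz≈xz∙y (sumOccupying r o (λ x → sumBumped true x (f ∘ (true ∷_)))) _ _)

-- Deleting the free spot a bumped car is about to take leaves its occupied left neighbour standing
-- for two spots.
sumOccupying-sumBumped : (N r : ℕ) (f : Street (suc N) → ℕ) →
  sumOccupying r (emptyStreet (suc N)) (λ o → sumBumped false o f)
    ≡ sumOccupying r (emptyStreet N) (λ o → sumDoubling o f)
sumOccupying-sumBumped zero    zero          f = refl
sumOccupying-sumBumped zero    (suc zero)    f = refl
sumOccupying-sumBumped zero    (suc (suc r)) f = refl
sumOccupying-sumBumped (suc N) zero          f = sumOccupying-sumBumped N zero (f ∘ (false ∷_))
sumOccupying-sumBumped (suc N) (suc r)       f = begin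
    sumOccupying r (false ∷ E) (λ o → sumBumped true o g₁)
      + sumOccupying (suc r) (false ∷ E) (λ o → sumBumped false o g₀)
  ≡⟨ cong₂ _+_ (sumOccupying-sumBumped-true r E g₁) (sumOccupying-sumBumped N (suc r) g₀) ⟩
    sumOccupying r (false ∷ E) (λ o → sumBumped false o g₁) + sumOccupying r E (g₁ ∘ (true ∷_))
      + sumOccupying (suc r) E (λ o → sumDoubling o g₀)
  ≡⟨ cong (λ n → n + sumOccupying r E (g₁ ∘ (true ∷_)) + sumOccupying (suc r) E (λ o → sumDoubling o g₀))
          (sumOccupying-sumBumped N r g₁) ⟩
    sumOccupying r E (λ o → sumDoubling o g₁) + sumOccupying r E (g₁ ∘ (true ∷_))
      + sumOccupying (suc r) E (λ o → sumDoubling o g₀)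
  ≡⟨ cong (_+ sumOccupying (suc r) E (λ o → sumDoubling o g₀))
          (trans (+-comm (sumOccupying r E (λ o → sumDoubling o g₁)) _)
                 (sym (sumOccupying-+ r E (g₁ ∘ (true ∷_)) (λ o → sumDoubling o g₁)))) ⟩
    sumOccupying (suc r) (false ∷ E) (λ o → sumDoubling o f) ∎
  where
  open ≡-Reasoning
  E = emptyStreet N
  g₁ g₀ : Street (suc N) → ℕ
  g₁ = f ∘ (true ∷_)
  g₀ = f ∘ (false ∷_)

parkingSum : ℕ → ℕ → ℕ → ℕ
parkingSum N r m = sumOccupying r (emptyStreet N) (λ o → #parking o m)

parkingSum-suc : (N r m : ℕ) →
  parkingSum (suc N) r (suc m) ≡ suc r * parkingSum (suc N) (suc r) m + r * parkingSum N r m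
parkingSum-suc N r m = begin
    sumOccupying r E′ (λ o → #parking o (suc m))
  ≡⟨ sumOccupying-cong r E′ (λ o → #parking-suc o m) ⟩
    sumOccupying r E′ (λ o → sumOccupying 1 o W + sumBumped false o W)
  ≡⟨ sumOccupying-+ r E′ _ _ ⟩
    sumOccupying r E′ (λ o → sumOccupying 1 o W) + sumOccupying r E′ (λ o → sumBumped false o W)
  ≡⟨ cong₂ _+_ (sumOccupying-sumOccupying r 1 E′ W) (sumOccupying-sumBumped N r W) ⟩
    ((r + 1) C r) * sumOccupying (r + 1) E′ W + sumOccupying r E (λ o → sumDoubling o W)
  ≡⟨ cong₂ _+_ (cong₂ (λ c n → c * sumOccupying n E′ W) ([r+1]Cr≡1+r r) (+-comm r 1))
               (sumOccupying-cong r E (λ o → sumDoubling-contraction o (#parking-contraction m))) ⟩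
    suc r * parkingSum (suc N) (suc r) m + sumOccupying r E (λ o → #occupied o * W o)
  ≡⟨ cong (suc r * parkingSum (suc N) (suc r) m +_)
          (trans (sumOccupying-#occupied r E W)
                 (cong (λ c → (c + r) * parkingSum N r m) (#occupied-emptyStreet N))) ⟩
    suc r * parkingSum (suc N) (suc r) m + r * parkingSum N r m ∎
  where
  open ≡-Reasoning
  E = emptyStreet N
  E′ = emptyStreet (suc N)
  W : {K : ℕ} → Street K → ℕ
  W o = #parking o m

r!*parkingSum≡rFub : (n r : ℕ) → r ! * parkingSum (n + r) r n ≡ rFub n r
r!*parkingSum≡rFub zero    r = trans (cong (r ! *_) (sumOccupying-all r (λ _ → 1))) (*-identityʳ (r !))
r!*parkingSum≡rFub (suc n) r = begin
    r ! * parkingSum (suc (n + r)) r (suc n)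
  ≡⟨ cong (r ! *_) (parkingSum-suc (n + r) r n) ⟩
    r ! * (suc r * P′ + r * P)
  ≡⟨ *-distribˡ-+ (r !) (suc r * P′) (r * P) ⟩
    r ! * (suc r * P′) + r ! * (r * P)
  ≡⟨ cong₂ _+_ (r!*[1+r]*x≡[1+r]!*x r P′) (*-Props.x∙yz≈y∙xz (r !) r P) ⟩
    suc r ! * P′ + r * (r ! * P)
  ≡⟨ cong₂ _+_ (trans (cong (λ N → suc r ! * parkingSum N (suc r) n) (sym (+-suc n r)))
                      (r!*parkingSum≡rFub n (suc r)))
               (cong (r *_) (r!*parkingSum≡rFub n r)) ⟩
    rFub n (suc r) + r * rFub n r
  ≡⟨ +-comm (rFub n (suc r)) (r * rFub n r) ⟩
    rFub (suc n) r ∎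
  where
  open ≡-Reasoning
  P′ = parkingSum (suc (n + r)) (suc r) n
  P  = parkingSum (n + r) r n

free-occupy : {N : ℕ} (o : Street N) (a y : Fin N) → free (occupy o a) y ≡ not (does (a ≟ᶠ y)) ∧ free o y
free-occupy o a y with a ≟ᶠ y
... | yes refl = cong not (lookup∘updateAt a o)
... | no a≢y   = cong not (lookup∘updateAt′ y a (a≢y ∘ sym) o)

∑-occupy-free : {N : ℕ} (o : Street N) (f : Street N → ℕ) →
  ∑[ a < N ] (𝟙 (free o a) * f (occupy o a)) ≡ sumOccupying 1 o f
∑-occupy-free []          f = refl
∑-occupy-free (false ∷ o) f = cong₂ _+_ (*-identityˡ (f (true ∷ o))) (∑-occupy-free o (f ∘ (false ∷_)))
∑-occupy-free (true ∷ o)  f = ∑-occupy-free o (f ∘ (true ∷_))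

parksDistinct : {N : ℕ} → Street N → ℕ → List (Fin N) → Bool
parksDistinct o r xs = parks o xs ∧ distinctWithin _≟ᶠ_ (free o) (L.take r xs)

parksDistinct-∷ : {N : ℕ} (o : Street N) (r : ℕ) (a : Fin N) (xs : List (Fin N)) →
  parksDistinct o (suc r) (a ∷ xs) ≡ free o a ∧ parksDistinct (occupy o a) r xs
parksDistinct-∷ o r a xs = begin
    parks o (a ∷ xs) ∧ distinctWithin _≟ᶠ_ (free o) (a ∷ L.take r xs)
  ≡⟨ cong (parks o (a ∷ xs) ∧_) (distinctWithin-∷ _≟ᶠ_ (free o) a (L.take r xs)) ⟩
    parks o (a ∷ xs)
      ∧ (free o a ∧ distinctWithin _≟ᶠ_ (λ y → not (does (a ≟ᶠ y)) ∧ free o y) (L.take r xs))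
  ≡⟨ cong (λ d → parks o (a ∷ xs) ∧ (free o a ∧ d))
          (distinctWithin-cong _≟ᶠ_ (λ y → sym (free-occupy o a y)) (L.take r xs)) ⟩
    parks o (a ∷ xs) ∧ (free o a ∧ distinctWithin _≟ᶠ_ (free (occupy o a)) (L.take r xs))
  ≡⟨ first-parks (lookup o a) refl ⟩
    free o a ∧ parksDistinct (occupy o a) r xs ∎
  where
  open ≡-Reasoning
  first-parks : (b : Bool) → lookup o a ≡ b →
    parks o (a ∷ xs) ∧ (not b ∧ distinctWithin _≟ᶠ_ (free (occupy o a)) (L.take r xs))
      ≡ not b ∧ parksDistinct (occupy o a) r xs
  first-parks true  _        = ∧-zeroʳ _
  first-parks false a-free rewrite parkOne-free o a a-free = refl

#parksDistinct : {N : ℕ} → Street N → ℕ → ℕ → ℕ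
#parksDistinct {N} o r L = #vecs L N (λ v → parksDistinct o r (toList v))

#parksDistinct-suc : {N : ℕ} (o : Street N) (r L : ℕ) →
  #parksDistinct o (suc r) (suc L) ≡ sumOccupying 1 o (λ o′ → #parksDistinct o′ r L)
#parksDistinct-suc {N} o r L = trans
  (sum-cong-≗ {N} λ a → trans (#vecs-cong {m = L} (λ v → parksDistinct-∷ o r a (toList v)))
                              (#vecs-∧ {m = L} (free o a) (λ v → parksDistinct (occupy o a) r (toList v))))
  (∑-occupy-free o (λ o′ → #parksDistinct o′ r L))

#parksDistinct-sumOccupying : {N : ℕ} (r m : ℕ) (o : Street N) →
  #parksDistinct o r (r + m) ≡ r ! * sumOccupying r o (λ x → #parking x m)
#parksDistinct-sumOccupying zero m o =
  trans (#vecs-cong {m = m} (λ v → ∧-identityʳ (parks o (toList v)))) (sym (+-identityʳ _))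
#parksDistinct-sumOccupying (suc r) m o = begin
    #parksDistinct o (suc r) (suc (r + m))
  ≡⟨ #parksDistinct-suc o r (r + m) ⟩
    sumOccupying 1 o (λ o′ → #parksDistinct o′ r (r + m))
  ≡⟨ sumOccupying-cong 1 o (#parksDistinct-sumOccupying r m) ⟩
    sumOccupying 1 o (λ o′ → r ! * sumOccupying r o′ W)
  ≡⟨ sumOccupying-* 1 (r !) o _ ⟩
    r ! * sumOccupying 1 o (λ o′ → sumOccupying r o′ W)
  ≡⟨ cong (r ! *_) (sumOccupying-sumOccupying 1 r o W) ⟩
    r ! * ((suc r C 1) * sumOccupying (suc r) o W)
  ≡⟨ cong (λ c → r ! * (c * sumOccupying (suc r) o W)) (nC1≡n (suc r)) ⟩
    r ! * (suc r * sumOccupying (suc r) o W)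
  ≡⟨ r!*[1+r]*x≡[1+r]!*x r (sumOccupying (suc r) o W) ⟩
    suc r ! * sumOccupying (suc r) o W ∎
  where
  open ≡-Reasoning
  W : {K : ℕ} → Street K → ℕ
  W x = #parking x m

all-free-emptyStreet : {N : ℕ} (xs : List (Fin N)) → all (free (emptyStreet N)) xs ≡ true
all-free-emptyStreet []       = refl
all-free-emptyStreet {N} (a ∷ xs) rewrite lookup-replicate a false = all-free-emptyStreet xs

countUPF≡#parksDistinct : (N r : ℕ) → countUPF N r ≡ #parksDistinct (emptyStreet N) r N
countUPF≡#parksDistinct N r =
  trans (length-filter-allVecs {k = N} {m = N} (λ α → isUPF? α ×-dec firstDistinct? r α))
        (#vecs-cong {m = N} same-condition)
  where
  same-condition : (α : Vec (Fin N) N) →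
    does (isUPF? α ×-dec firstDistinct? r α) ≡ parksDistinct (emptyStreet N) r (toList α)
  same-condition α = cong₂ _∧_ (does-≟-true (parks (emptyStreet N) (toList α)))
    (trans (sym (∧-identityʳ _)) (cong (does (unique? _≟ᶠ_ (L.take r (toList α))) ∧_)
                                       (sym (all-free-emptyStreet (L.take r (toList α))))))

countUPF≡rFub : (n r : ℕ) → countUPF (n + r) r ≡ rFub n r
countUPF≡rFub n r = begin
    countUPF (n + r) r
  ≡⟨ countUPF≡#parksDistinct (n + r) r ⟩
    #parksDistinct (emptyStreet (n + r)) r (n + r)
  ≡⟨ cong (#parksDistinct (emptyStreet (n + r)) r) (+-comm n r) ⟩
    #parksDistinct (emptyStreet (n + r)) r (r + n)
  ≡⟨ #parksDistinct-sumOccupying r n (emptyStreet (n + r)) ⟩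
    r ! * parkingSum (n + r) r n
  ≡⟨ r!*parkingSum≡rFub n r ⟩
    rFub n r ∎
  where open ≡-Reasoning

-- Restricted growth strings

completes : {j : ℕ} → ℕ → List (Fin j) → ℕ → Bool
completes u xs j = does (≡-dec _≟_ (rgsBlocks u xs) (just j))

completes-∷ : {j : ℕ} (u : ℕ) (a : Fin j) (xs : List (Fin j)) →
  completes u (a ∷ xs) j ≡ (toℕ a ≤ᵇ u) ∧ completes (u ⊔ suc (toℕ a)) xs j
completes-∷ u a xs with toℕ a ≤? u
... | yes a≤u rewrite dec-true (toℕ a ≤? u) a≤u = refl
... | no  a≰u rewrite dec-false (toℕ a ≤? u) a≰u = refl

rgsBlocks-bounds : {j : ℕ} (u : ℕ) (xs : List (Fin j)) {k : ℕ} →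
  rgsBlocks u xs ≡ just k → u ≤ k × k ≤ u + length xs
rgsBlocks-bounds u [] refl = ≤-refl , m≤m+n u 0
rgsBlocks-bounds u (a ∷ xs) {k} eq with toℕ a ≤? u
... | no _ with () ← eq
... | yes a≤u with rgsBlocks-bounds (u ⊔ suc (toℕ a)) xs eq
...   | u′≤k , k≤u′+n = ≤-trans (m≤m⊔n u _) u′≤k , (begin
  k                                ≤⟨ k≤u′+n ⟩
  u ⊔ suc (toℕ a) + length xs      ≤⟨ +-monoˡ-≤ (length xs) (⊔-lub (n≤1+n u) (s≤s a≤u)) ⟩
  suc u + length xs                ≡⟨ sym (+-suc u (length xs)) ⟩
  u + length (a ∷ xs)              ∎)
  where open ≤-Reasoning

#rgs : ℕ → ℕ → ℕ → ℕ
#rgs L u j = #vecs L j (λ v → completes u (toList v) j)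

#rgs-outside : (L u j : ℕ) → j < u ⊎ u + L < j → #rgs L u j ≡ 0
#rgs-outside L u j outside = trans (#vecs-cong {m = L} never) (#vecs-false {L} {j})
  where
  never : (v : Vec (Fin j) L) → completes u (toList v) j ≡ false
  never v = dec-false (≡-dec _≟_ (rgsBlocks u (toList v)) (just j)) λ eq →
    let u≤j , j≤u+L = rgsBlocks-bounds u (toList v) eq in
    [ (λ j<u → <⇒≱ j<u u≤j)
    , (λ u+L<j → <⇒≱ u+L<j (subst (λ n → j ≤ u + n) (length-toList v) j≤u+L))
    ]′ outside

#rgs-self : (u : ℕ) → #rgs 0 u u ≡ 1
#rgs-self u = cong 𝟙 (dec-true (≡-dec _≟_ (just u) (just u)) refl)

#rgs-suc : (L u j : ℕ) → u ≤ j → #rgs (suc L) u j ≡ u * #rgs L u j + #rgs L (suc u) j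
#rgs-suc L u j u≤j = trans first-letter (reuse-or-open (m≤n⇒m<n∨m≡n u≤j))
  where
  open ≡-Reasoning
  continue : ℕ → ℕ
  continue i = #rgs L (u ⊔ suc i) j
  first-letter : #rgs (suc L) u j ≡ ∑[ i < j ⊓ suc u ] continue (toℕ i)
  first-letter = trans
    (sum-cong-≗ {j} λ a → trans
      (#vecs-cong {m = L} (λ v → completes-∷ u a (toList v)))
      (#vecs-∧ {m = L} (toℕ a ≤ᵇ u) (λ v → completes (u ⊔ suc (toℕ a)) (toList v) j)))
    (∑-≤ᵇ continue u j)
  old-block : (i : Fin u) → continue (toℕ i) ≡ #rgs L u j
  old-block i = cong (λ n → #rgs L n j) (m≥n⇒m⊔n≡m (toℕ<n i))
  reuse-or-open : u < j ⊎ u ≡ j → ∑[ i < j ⊓ suc u ] continue (toℕ i) ≡ u * #rgs L u j + #rgs L (suc u) j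
  reuse-or-open (inj₁ u<j) = begin
      ∑[ i < j ⊓ suc u ] continue (toℕ i)
    ≡⟨ cong (λ n → ∑[ i < n ] continue (toℕ i)) (m≥n⇒m⊓n≡n u<j) ⟩
      ∑[ i < suc u ] continue (toℕ i)
    ≡⟨ sum-init-last (λ i → continue (toℕ i)) ⟩
      ∑[ i < u ] continue (toℕ (inject₁ i)) + continue (toℕ (fromℕ u))
    ≡⟨ cong₂ _+_ (sum-cong-≗ {u} λ i → trans (cong continue (toℕ-inject₁ i)) (old-block i))
                 (cong (λ n → #rgs L (u ⊔ suc n) j) (toℕ-fromℕ u)) ⟩
      ∑[ i < u ] #rgs L u j + #rgs L (u ⊔ suc u) j
    ≡⟨ cong₂ _+_ (∑-const u (#rgs L u j)) (cong (λ n → #rgs L n j) (m≤n⇒m⊔n≡n (n≤1+n u))) ⟩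
      u * #rgs L u j + #rgs L (suc u) j ∎
  reuse-or-open (inj₂ refl) = begin
      ∑[ i < u ⊓ suc u ] continue (toℕ i)
    ≡⟨ cong (λ n → ∑[ i < n ] continue (toℕ i)) (m≤n⇒m⊓n≡m (n≤1+n u)) ⟩
      ∑[ i < u ] continue (toℕ i)
    ≡⟨ trans (sum-cong-≗ {u} old-block) (∑-const u (#rgs L u u)) ⟩
      u * #rgs L u u
    ≡⟨ sym (+-identityʳ _) ⟩
      u * #rgs L u u + 0
    ≡⟨ cong (u * #rgs L u u +_) (sym (#rgs-outside L (suc u) u (inj₁ (n<1+n u)))) ⟩
      u * #rgs L u u + #rgs L (suc u) u ∎

≤ᵇ-avoiding : {j u : ℕ} (a y : Fin j) → toℕ a ≡ u →
  not (does (a ≟ᶠ y)) ∧ (u ≤ᵇ toℕ y) ≡ (suc u ≤ᵇ toℕ y)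
≤ᵇ-avoiding a y refl with <-cmp (toℕ a) (toℕ y)
... | tri< a<y _ _ = trans
  (cong₂ (λ b c → not b ∧ c) (dec-false (a ≟ᶠ y) (<⇒≢ a<y ∘ cong toℕ))
                            (dec-true (toℕ a ≤? toℕ y) (<⇒≤ a<y)))
  (sym (dec-true (suc (toℕ a) ≤? toℕ y) a<y))
... | tri≈ _ a≡y _ = trans
  (cong (λ b → not b ∧ (toℕ a ≤ᵇ toℕ y)) (dec-true (a ≟ᶠ y) (toℕ-injective a≡y)))
  (sym (dec-false (suc (toℕ a) ≤? toℕ y) (<-irrefl a≡y)))
... | tri> _ _ y<a = trans
  (trans (cong (not (does (a ≟ᶠ y)) ∧_) (dec-false (toℕ a ≤? toℕ y) (<⇒≱ y<a))) (∧-zeroʳ _))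
  (sym (dec-false (suc (toℕ a) ≤? toℕ y) (<-asym y<a)))

rgsDistinct : {j : ℕ} → ℕ → ℕ → List (Fin j) → ℕ → Bool
rgsDistinct u r xs j = completes u xs j ∧ distinctWithin _≟ᶠ_ (λ y → u ≤ᵇ toℕ y) (L.take r xs)

rgsDistinct-∷ : {j : ℕ} (u r : ℕ) (a : Fin j) (xs : List (Fin j)) →
  rgsDistinct u (suc r) (a ∷ xs) j ≡ (toℕ a ≡ᵇ u) ∧ rgsDistinct (suc u) r xs j
rgsDistinct-∷ {j} u r a xs = trans
  (cong₂ _∧_ (completes-∷ u a xs) (distinctWithin-∷ _≟ᶠ_ (λ y → u ≤ᵇ toℕ y) a (L.take r xs)))
  (by-order (<-cmp (toℕ a) u))
  where
  rest : Bool
  rest = completes (u ⊔ suc (toℕ a)) xs j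
  others-new : Bool
  others-new = distinctWithin _≟ᶠ_ (λ y → not (does (a ≟ᶠ y)) ∧ (u ≤ᵇ toℕ y)) (L.take r xs)
  by-order : Tri (toℕ a < u) (toℕ a ≡ u) (u < toℕ a) →
    ((toℕ a ≤ᵇ u) ∧ rest) ∧ ((u ≤ᵇ toℕ a) ∧ others-new)
      ≡ (toℕ a ≡ᵇ u) ∧ rgsDistinct (suc u) r xs j
  by-order (tri< a<u _ _)
    rewrite dec-false (u ≤? toℕ a) (<⇒≱ a<u) | dec-false (toℕ a ≟ u) (<⇒≢ a<u) = ∧-zeroʳ _
  by-order (tri> _ _ u<a)
    rewrite dec-false (toℕ a ≤? u) (<⇒≱ u<a) | dec-false (toℕ a ≟ u) (>⇒≢ u<a) = refl
  by-order (tri≈ _ a≡u _)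
    rewrite dec-true (toℕ a ≤? u) (≤-reflexive a≡u) | dec-true (u ≤? toℕ a) (≤-reflexive (sym a≡u))
          | dec-true (toℕ a ≟ u) a≡u = cong₂ _∧_
      (cong (λ n → completes n xs j) (trans (cong (λ n → u ⊔ suc n) a≡u) (m≤n⇒m⊔n≡n (n≤1+n u))))
      (distinctWithin-cong _≟ᶠ_ (λ y → ≤ᵇ-avoiding a y a≡u) (L.take r xs))

#rgsDistinct : ℕ → ℕ → ℕ → ℕ → ℕ
#rgsDistinct u r L j = #vecs L j (λ v → rgsDistinct u r (toList v) j)

#rgsDistinct≡#rgs : (r L u j : ℕ) → u + r ≤ j → #rgsDistinct u r (r + L) j ≡ #rgs L (u + r) j
#rgsDistinct≡#rgs zero    L u j _ = trans (#vecs-cong {m = L} (λ v → ∧-identityʳ (completes u (toList v) j)))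
                                          (cong (λ n → #rgs L n j) (sym (+-identityʳ u)))
#rgsDistinct≡#rgs (suc r) L u j u+r<j = begin
    ∑[ a < j ] #vecs (r + L) j (λ v → rgsDistinct u (suc r) (a ∷ toList v) j)
  ≡⟨ sum-cong-≗ {j} (λ a → trans (#vecs-cong {m = r + L} (λ v → rgsDistinct-∷ u r a (toList v)))
                                 (#vecs-∧ {m = r + L} (toℕ a ≡ᵇ u) _)) ⟩
    ∑[ a < j ] (𝟙 (toℕ a ≡ᵇ u) * #rgsDistinct (suc u) r (r + L) j)
  ≡⟨ ∑-≡ᵇ (λ _ → #rgsDistinct (suc u) r (r + L) j) (<-≤-trans (m<m+n u z<s) u+r<j) ⟩
    #rgsDistinct (suc u) r (r + L) j
  ≡⟨ #rgsDistinct≡#rgs r L (suc u) j (subst (_≤ j) (+-suc u r) u+r<j) ⟩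
    #rgs L (suc u + r) j
  ≡⟨ cong (λ n → #rgs L n j) (sym (+-suc u r)) ⟩
    #rgs L (u + suc r) j ∎
  where open ≡-Reasoning

rStirling2≡#rgs : (r n k : ℕ) → rStirling2 r (n + r) (k + r) ≡ #rgs n r (k + r)
rStirling2≡#rgs r n k = begin
    rStirling2 r (n + r) (k + r)
  ≡⟨ length-filter-allVecs {k = k + r} {m = n + r} (λ f → isPartition? f ×-dec firstSeparated? r f) ⟩
    #vecs (n + r) (k + r) (λ f → does (isPartition? f ×-dec firstSeparated? r f))
  ≡⟨ #vecs-cong {m = n + r} (λ f → cong (completes 0 (toList f) (k + r) ∧_)
                                      (sym (trans (cong (does (unique? _≟ᶠ_ (L.take r (toList f))) ∧_)
                                                        (all-true (L.take r (toList f))))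
                                                  (∧-identityʳ _)))) ⟩
    #rgsDistinct 0 r (n + r) (k + r)
  ≡⟨ cong (λ L → #rgsDistinct 0 r L (k + r)) (+-comm n r) ⟩
    #rgsDistinct 0 r (r + n) (k + r)
  ≡⟨ #rgsDistinct≡#rgs r n 0 (k + r) (m≤n+m r k) ⟩
    #rgs n r (k + r) ∎
  where open ≡-Reasoning

fubiniSum : ℕ → ℕ → ℕ
fubiniSum n u = ∑[ k < suc n ] ((toℕ k + u) ! * #rgs n u (toℕ k + u))

fubiniSum-extend : (n u : ℕ) →
  ∑[ k < suc (suc n) ] ((toℕ k + u) ! * #rgs n u (toℕ k + u)) ≡ fubiniSum n u
fubiniSum-extend n u = begin
    ∑[ k < suc (suc n) ] term (toℕ k)
  ≡⟨ sum-init-last {suc n} (λ k → term (toℕ k)) ⟩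
    ∑[ k < suc n ] term (toℕ (inject₁ k)) + term (toℕ (fromℕ (suc n)))
  ≡⟨ cong₂ _+_ (sum-cong-≗ {suc n} (cong term ∘ toℕ-inject₁)) (cong term (toℕ-fromℕ (suc n))) ⟩
    fubiniSum n u + (suc n + u) ! * #rgs n u (suc n + u)
  ≡⟨ cong (λ x → fubiniSum n u + (suc n + u) ! * x)
          (#rgs-outside n u (suc n + u) (inj₂ (s≤s (≤-reflexive (+-comm u n))))) ⟩
    fubiniSum n u + (suc n + u) ! * 0
  ≡⟨ cong (fubiniSum n u +_) (*-zeroʳ ((suc n + u) !)) ⟩
    fubiniSum n u + 0
  ≡⟨ +-identityʳ _ ⟩
    fubiniSum n u ∎
  where
  open ≡-Reasoning
  term : ℕ → ℕ
  term k = (k + u) ! * #rgs n u (k + u)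

fubiniSum-shift : (n u : ℕ) →
  ∑[ k < suc (suc n) ] ((toℕ k + u) ! * #rgs n (suc u) (toℕ k + u)) ≡ fubiniSum n (suc u)
fubiniSum-shift n u = cong₂ _+_
  (trans (cong (u ! *_) (#rgs-outside n (suc u) u (inj₁ (n<1+n u)))) (*-zeroʳ (u !)))
  (sum-cong-≗ {suc n} λ k → cong (λ m → m ! * #rgs n (suc u) m) (sym (+-suc (toℕ k) u)))

fubiniSum-suc : (n u : ℕ) → fubiniSum (suc n) u ≡ u * fubiniSum n u + fubiniSum n (suc u)
fubiniSum-suc n u = begin
    ∑[ k < suc (suc n) ] ((toℕ k + u) ! * #rgs (suc n) u (toℕ k + u))
  ≡⟨ sum-cong-≗ {suc (suc n)} (λ k → split (toℕ k)) ⟩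
    ∑[ k < suc (suc n) ] (u * old (toℕ k) + new (toℕ k))
  ≡⟨ ∑-distrib-+ {suc (suc n)} (λ k → u * old (toℕ k)) (λ k → new (toℕ k)) ⟩
    ∑[ k < suc (suc n) ] (u * old (toℕ k)) + ∑[ k < suc (suc n) ] new (toℕ k)
  ≡⟨ cong (_+ ∑[ k < suc (suc n) ] new (toℕ k))
          (sym (*-distribˡ-sum {suc (suc n)} u (λ k → old (toℕ k)))) ⟩
    u * ∑[ k < suc (suc n) ] old (toℕ k) + ∑[ k < suc (suc n) ] new (toℕ k)
  ≡⟨ cong₂ _+_ (cong (u *_) (fubiniSum-extend n u)) (fubiniSum-shift n u) ⟩
    u * fubiniSum n u + fubiniSum n (suc u) ∎
  where
  open ≡-Reasoning
  old new : ℕ → ℕ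
  old k = (k + u) ! * #rgs n u (k + u)
  new k = (k + u) ! * #rgs n (suc u) (k + u)
  split : (k : ℕ) → (k + u) ! * #rgs (suc n) u (k + u) ≡ u * old k + new k
  split k = trans (cong ((k + u) ! *_) (#rgs-suc n u (k + u) (m≤n+m u k)))
    (trans (*-distribˡ-+ ((k + u) !) _ _) (cong (_+ new k) (*-Props.x∙yz≈y∙xz ((k + u) !) u _)))

fubiniSum≡rFub : (n u : ℕ) → fubiniSum n u ≡ rFub n u
fubiniSum≡rFub zero    u = trans (+-identityʳ _) (trans (cong (u ! *_) (#rgs-self u)) (*-identityʳ (u !)))
fubiniSum≡rFub (suc n) u = trans (fubiniSum-suc n u)
  (cong₂ _+_ (cong (u *_) (fubiniSum≡rFub n u)) (fubiniSum≡rFub n (suc u)))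

rFubini≡rFub : (n r : ℕ) → rFubini n r ≡ rFub n r
rFubini≡rFub n r = begin
    rFubini n r
  ≡⟨ sum-map-applyUpTo (λ k → (k + r) ! * rStirling2 r (n + r) (k + r)) id (suc n) ⟩
    ∑[ k < suc n ] ((toℕ k + r) ! * rStirling2 r (n + r) (toℕ k + r))
  ≡⟨ sum-cong-≗ {suc n} (λ k → cong ((toℕ k + r) ! *_) (rStirling2≡#rgs r n (toℕ k))) ⟩
    fubiniSum n r
  ≡⟨ fubiniSum≡rFub n r ⟩
    rFub n r ∎
  where open ≡-Reasoning

theorem3p6 : (r n : ℕ) → r ≥ 1 → countUPF (n + r) r ≡ rFubini n r
theorem3p6 r n _ = trans (countUPF≡rFub n r) (sym (rFubini≡rFub n r))
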